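{- Let $\vec a,\vec b,\vec c,\vec d\in\mathcal C$ be of bounded norm and $n\in\mathbb N$ with $\mathrm{lv}(\vec a)=\mathrm{lv}(\vec c)=n+1>\mathrm{lv}(\vec b),\mathrm{lv}(\vec d)$. Setting $\vec e:=(\vec a\Box\vec b)\Box(\vec c\Box\vec d\restriction_n)$ we have $\mathrm{no}(e_i)\prec F_3(a_0+b_0+c_0+d_0+n)$ for $1\le i\le n+1$.
   Context: Ordinals: $\oplus,\otimes$ natural sum/product below $\varepsilon_0$; $2^\alpha:=\omega^{\alpha_0}2^k$ for $\alpha=\omega\alpha_0+k$; $\mathrm{no}(0)=0$, $\mathrm{no}(\omega^{\alpha_1}+\dots+\omega^{\alpha_k})=k+\sum_i\mathrm{no}(\alpha_i)$; $F_0(x)=2^x$, $F_{j+1}(x)=F_j^{x+1}(x)$, $\Phi(x)=F_5(x+100)$; $\psi(\alpha)=\max(\{0\}\cup\{\psi(\beta)+1:\beta<\alpha,\mathrm{no}(\beta)\le\Phi(\mathrm{no}(\alpha))\})$. Each typed variable $Y^\rho$ has a vector $\vec y=\langle y_0,\dots,y_{\mathrm{lv}(\rho)}\rangle$ of distinct ordinal variables (disjoint for distinct variables). Ordinal terms: ordinal variables, $0,1,\omega$, $f+g$, $2^f\cdot g$, $\psi(\omega f+g)$; closed terms denote ordinals ($+$ as $\oplus$, $\cdot$ as $\otimes$). Vectors $\langle h_0,\dots,h_n\rangle$ of level $n$, $h_i=0$ for $i>n$. $\mathcal B_i$: $1\in\mathcal B_i$; $\omega\in\mathcal B_i$ ($i\ge1$);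 closed under $+$; $2^fg\in\mathcal B_i$ if $f\in\mathcal B_{i+1},g\in\mathcal B_i,i\ge1$; $\psi(\omega f+g)\in\mathcal B_0$ if $f\in\mathcal B_1,g\in\mathcal B_0,\mathrm{no}(f)\le F_2(g)$; $\mathcal B_0\subseteq\mathcal B_i$. Closed $\vec f$ has bounded norm if $\mathrm{no}(f_i)\le\mathrm{no}(f_0)$. $f\prec g$ / $\preceq$ (also for expressions built with $\mathrm{no}$, $F_j$): holds under every substitution $\chi$ of the variable vectors occurring by vectors with $\chi(x_i)\in\mathcal B_i$ of bounded norm. A vector $\vec f$ has bounded norm if $\mathrm{no}(f_i)\preceq\mathrm{no}(f_0)$ for all $i$. $\mathcal C_i$: $1\in\mathcal C_i$; $\omega\in\mathcal C_i$ ($i\ge1$); $y^\rho_i\in\mathcal C_i$ for $i\le\mathrm{lv}(\rho)$; closed under $+$; $2^fg\in\mathcal C_i$ if $f\in\mathcal C_{i+1},g\in\mathcal C_i,i\ge1$; $\psi(\omega f+g)\in\mathcal C_0$ if $f\in\mathcal C_1,g\in\mathcal C_0,\mathrm{no}(f)\preceq F_2(g)$; $\mathcal C_0\subseteq\mathcal C_i$. $\mathcal C$: vectors with $h_i\in\mathcal C_i$. $\Box$: for $m=\mathrm{lv}(\vec f)>\mathrm{lv}(\vec g)=n$: $(\vec f\Box\vec g)_0=\psi(\omega(\vec f\Box\vec g)_1+f_0+g_0+n)$, $(\vec f\Box\vec g)_i=2^{(\vec f\Box\vec g)_{i+1}}(f_i+g_i)$ ($1\le i\le n$), $=f_i$ ($n<i\le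 m$); $\restriction_i$ restricts to components $0,\dots,i$. -}

module Defs where

open import Data.Nat using (ℕ; zero; suc; _+_; _^_; _∸_; _≤_; _<_; _≤ᵇ_)
open import Data.Bool using (if_then_else_)
open import Data.Product using (Σ; _×_; _,_)
open import Data.Sum using (_⊎_)
open import Relation.Binary.PropositionalEquality using (_≡_)

-- Ordinals below ε₀ in Cantor normal form:  ω^ a + b  stands for ω^a + b.

data Ord : Set where
  𝟎    : Ord
  ω^_+_ : Ord → Ord → Ord

data Cmp : Set where
  lt eq gt : Cmp

cmp : Ord → Ord → Cmp
cmp 𝟎 𝟎 = eq
cmp 𝟎 (ω^ _ + _) = lt
cmp (ω^ _ + _) 𝟎 = gt
cmp (ω^ a + b) (ω^ c + d) with cmp a c
... | lt = lt
... | gt = gt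
... | eq = cmp b d

_<ₒ_ : Ord → Ord → Set
a <ₒ b = cmp a b ≡ lt

_≤ₒ_ : Ord → Ord → Set
a ≤ₒ b = a <ₒ b ⊎ a ≡ b

data IsCNF : Ord → Set where
  cnf0 : IsCNF 𝟎
  cnf1 : ∀ {a} → IsCNF a → IsCNF (ω^ a + 𝟎)
  cnf2 : ∀ {a c d} → IsCNF a → IsCNF (ω^ c + d) → c ≤ₒ a → IsCNF (ω^ a + (ω^ c + d))

-- natural (Hessenberg) sum ⊕ : merge of Cantor normal forms
sel : Cmp → Ord → Ord → Ord
sel lt x y = x
sel eq x y = y
sel gt x y = y

mutual
  _⊕_ : Ord → Ord → Ord
  𝟎 ⊕ y = y
  (ω^ a + b) ⊕ y = ins a b y

  ins : Ord → Ord → Ord → Ord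
  ins a b 𝟎 = ω^ a + b
  ins a b (ω^ c + d) = sel (cmp a c) (ω^ c + ins a b d) (ω^ a + (b ⊕ (ω^ c + d)))

ωmul : Ord → Ord → Ord
ωmul a 𝟎 = 𝟎
ωmul a (ω^ c + d) = ω^ (a ⊕ c) + ωmul a d

_⊗_ : Ord → Ord → Ord
𝟎 ⊗ y = 𝟎
(ω^ a + b) ⊗ y = ωmul a y ⊕ (b ⊗ y)

fromℕ : ℕ → Ord
fromℕ zero = 𝟎
fromℕ (suc n) = ω^ 𝟎 + fromℕ n

oneₒ : Ord
oneₒ = ω^ 𝟎 + 𝟎

ωₒ : Ord
ωₒ = ω^ oneₒ + 𝟎

-- finite part k of α = ω·α₀ + k  (for finite α this is its value)
fin : Ord → ℕ
fin 𝟎 = 0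
fin (ω^ 𝟎 + b) = suc (fin b)
fin (ω^ (ω^ _ + _) + b) = fin b

-- -1+β  (β ≥ 1)
dec1 : Ord → Ord
dec1 𝟎 = 𝟎
dec1 (ω^ 𝟎 + b) = b
dec1 x@(ω^ (ω^ _ + _) + _) = x

-- α₀ where α = ω·α₀ + k
ωquot : Ord → Ord
ωquot 𝟎 = 𝟎
ωquot (ω^ 𝟎 + b) = ωquot b
ωquot (ω^ a@(ω^ _ + _) + b) = ω^ (dec1 a) + ωquot b

-- 2^α := ω^{α₀} · 2^k  for α = ω·α₀ + k
pow2 : Ord → Ord
pow2 α = ωmul (ωquot α) (fromℕ (2 ^ fin α))

noₒ : Ord → ℕ
noₒ 𝟎 = 0
noₒ (ω^ a + b) = suc (noₒ a + noₒ b)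

iter : (ℕ → ℕ) → ℕ → ℕ → ℕ
iter f zero x = x
iter f (suc k) x = f (iter f k x)

F : ℕ → ℕ → ℕ
F zero x = 2 ^ x
F (suc j) x = iter (F j) (suc x) x

Φ : ℕ → ℕ
Φ x = F 5 (x + 100)

-- ψ is characterised by its defining recursion (on ordinals in CNF):
-- ψ(α) = max({0} ∪ {ψ(β)+1 : β < α, no(β) ≤ Φ(no(α))}).
IsPsi : (Ord → ℕ) → Set
IsPsi ψ = ∀ α → IsCNF α →
  (∀ β → IsCNF β → β <ₒ α → noₒ β ≤ Φ (noₒ α) → suc (ψ β) ≤ ψ α)
  × (ψ α ≡ 0 ⊎ Σ Ord (λ β → IsCNF β × β <ₒ α × noₒ β ≤ Φ (noₒ α) × ψ α ≡ suc (ψ β)))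

-- Ordinal terms.  var v i is the ordinal variable y_i of the typed variable
-- with index v.  tpow f g = 2^f·g,  tpsi f g = ψ(ωf+g).

data Tm : Set where
  var  : ℕ → ℕ → Tm
  tzero tone tω : Tm
  _+ₜ_ : Tm → Tm → Tm
  tpow : Tm → Tm → Tm
  tpsi : Tm → Tm → Tm

module _ (ψ : Ord → ℕ) where

  eval : (ℕ → ℕ → Ord) → Tm → Ord
  eval ρ (var v i) = ρ v i
  eval ρ tzero = 𝟎
  eval ρ tone = oneₒ
  eval ρ tω = ωₒ
  eval ρ (f +ₜ g) = eval ρ f ⊕ eval ρ g
  eval ρ (tpow f g) = pow2 (eval ρ f) ⊗ eval ρ g
  eval ρ (tpsi f g) = fromℕ (ψ ((ωₒ ⊗ eval ρ f) ⊕ eval ρ g))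

  evalc : Tm → Ord
  evalc = eval (λ _ _ → 𝟎)

  data B : ℕ → Tm → Set where
    b1   : ∀ {i} → B i tone
    bω   : ∀ {i} → B (suc i) tω
    b+   : ∀ {i f g} → B i f → B i g → B i (f +ₜ g)
    bpow : ∀ {i f g} → B (suc (suc i)) f → B (suc i) g → B (suc i) (tpow f g)
    bpsi : ∀ {f g} → B 1 f → B 0 g → noₒ (evalc f) ≤ F 2 (fin (evalc g)) → B 0 (tpsi f g)
    b0   : ∀ {i f} → B 0 f → B i f

  -- substitutions of the variable vectors; lvV v is the level of the type of variable v
  Subst : Set
  Subst = ℕ → ℕ → Tm

  Admissible : (ℕ → ℕ) → Subst → Set
  Admissible lvV χ = ∀ v i →
    (i ≤ lvV v → B i (χ v i) × noₒ (evalc (χ v i)) ≤ noₒ (evalc (χ v 0)))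
    × (lvV v < i → χ v i ≡ tzero)

  ⟦_⟧ : Tm → Subst → Ord
  ⟦ t ⟧ χ = eval (λ v i → evalc (χ v i)) t

  data C (lvV : ℕ → ℕ) : ℕ → Tm → Set where
    c1   : ∀ {i} → C lvV i tone
    cω   : ∀ {i} → C lvV (suc i) tω
    cvar : ∀ {v i} → i ≤ lvV v → C lvV i (var v i)
    c+   : ∀ {i f g} → C lvV i f → C lvV i g → C lvV i (f +ₜ g)
    cpow : ∀ {i f g} → C lvV (suc (suc i)) f → C lvV (suc i) g → C lvV (suc i) (tpow f g)
    cpsi : ∀ {f g} → C lvV 1 f → C lvV 0 g →
           (∀ χ → Admissible lvV χ → noₒ (⟦ f ⟧ χ) ≤ F 2 (fin (⟦ g ⟧ χ))) →
           C lvV 0 (tpsi f g)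
    c0   : ∀ {i f} → C lvV 0 f → C lvV i f

-- Vectors ⟨h_0,…,h_lv⟩ (components above lv are irrelevant / 0)

record Vect : Set where
  constructor vect
  field
    lv   : ℕ
    comp : ℕ → Tm
open Vect public

module _ (ψ : Ord → ℕ) (lvV : ℕ → ℕ) where

  InC : Vect → Set
  InC h = ∀ i → i ≤ lv h → C ψ lvV i (comp h i)

  BoundedNorm : Vect → Set
  BoundedNorm h = ∀ i → i ≤ lv h → ∀ χ → Admissible ψ lvV χ →
    noₒ (⟦_⟧ ψ (comp h i) χ) ≤ noₒ (⟦_⟧ ψ (comp h 0) χ)

num : ℕ → Tm
num zero = tzero
num (suc k) = tone +ₜ num k

-- f □ g  (intended for lv f > lv g)
_□_ : Vect → Vect → Vect
f □ g = vect (lv f) comp'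
  where
  m n : ℕ
  m = lv f
  n = lv g
  -- chain i k = (f □ g)_i  where k = n + 1 - i
  chain : ℕ → ℕ → Tm
  chain i zero = comp f i
  chain i (suc k) = tpow (chain (suc i) k) (comp f i +ₜ comp g i)
  comp' : ℕ → Tm
  comp' zero = tpsi (chain 1 n) ((comp f 0 +ₜ comp g 0) +ₜ num n)
  comp' (suc j) = if suc j ≤ᵇ n then chain (suc j) (n ∸ j)
                  else (if suc j ≤ᵇ m then comp f (suc j) else tzero)

_↾_ : Vect → ℕ → Vect
h ↾ i = vect i (λ j → if j ≤ᵇ i then comp h j else tzero)

-- The level-0 components of vectors in 𝒞 are sums of 1s and ψ-values, hence finite ordinals, so
-- bounded norm bounds the norms of all components of a, b, c, d by the finite part A of
-- a₀ + b₀ + c₀ + d₀ + n. A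
-- component of f □ g of level ≥ 1 is either a component of f or 2^((f □ g)_{i+1})·(f_i + g_i),
-- and the norm of the latter is at most powBound of the norms involved. Hence the positive
-- components of e are bounded by 2n ≤ 2A iterations of powBound starting from A, and
-- powBound ≤ F₀⁴ together with F₀^(8A) ≤ F₁⁸ < F₃ gives the claim.
module Submission where

open import Defs
open import Data.Nat
open import Data.Nat.Properties
open import Algebra.Properties.CommutativeSemigroup +-commutativeSemigroup using (x∙yz≈y∙xz)
open import Data.Bool using (true; false; T)
open import Data.Product using (proj₁)
open import Data.Sum using (inj₁; inj₂)
open import Function using (_∘_)
open import Relation.Binary.Core using (_Preserves_⟶_)
open import Relation.Binary.PropositionalEquality
open import Relation.Nullary using (contradiction)
open import Data.Nat.Solver using (module +-*-Solver)
open +-*-Solver using (solve; _:+_; _:*_; con; _:=_)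

-- ⊕ merges the Cantor terms of its arguments, so every sum of per-term weights is additive.
module TermWeight (w : Ord → ℕ) where

  weight : Ord → ℕ
  weight 𝟎 = 0
  weight (ω^ a + b) = w a + weight b

  mutual
    weight-⊕ : ∀ x y → weight (x ⊕ y) ≡ weight x + weight y
    weight-⊕ 𝟎 y = refl
    weight-⊕ (ω^ a + b) y = weight-ins a b y

    weight-ins : ∀ a b y → weight (ins a b y) ≡ weight (ω^ a + b) + weight y
    weight-ins a b 𝟎 = sym (+-identityʳ _)
    weight-ins a b (ω^ c + d) with cmp a c
    ... | lt = trans (cong (w c +_) (weight-ins a b d)) (x∙yz≈y∙xz (w c) (w a + weight b) (weight d))
    ... | eq = trans (cong (w a +_) (weight-⊕ b (ω^ c + d))) (sym (+-assoc (w a) (weight b) _))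
    ... | gt = trans (cong (w a +_) (weight-⊕ b (ω^ c + d))) (sym (+-assoc (w a) (weight b) _))

noₒ-⊕ : ∀ x y → noₒ (x ⊕ y) ≡ noₒ x + noₒ y
noₒ-⊕ x y = begin
  noₒ (x ⊕ y)              ≡⟨ noₒ-weight (x ⊕ y) ⟩
  weight (x ⊕ y)           ≡⟨ weight-⊕ x y ⟩
  weight x + weight y      ≡⟨ sym (cong₂ _+_ (noₒ-weight x) (noₒ-weight y)) ⟩
  noₒ x + noₒ y            ∎
  where
  open TermWeight (suc ∘ noₒ)
  open ≡-Reasoning
  noₒ-weight : ∀ x → noₒ x ≡ weight x
  noₒ-weight 𝟎 = refl
  noₒ-weight (ω^ a + b) = cong (suc ∘ (noₒ a +_)) (noₒ-weight b)

fin-⊕ : ∀ x y → fin (x ⊕ y) ≡ fin x + fin y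
fin-⊕ x y = begin
  fin (x ⊕ y)              ≡⟨ fin-weight (x ⊕ y) ⟩
  weight (x ⊕ y)           ≡⟨ weight-⊕ x y ⟩
  weight x + weight y      ≡⟨ sym (cong₂ _+_ (fin-weight x) (fin-weight y)) ⟩
  fin x + fin y            ∎
  where
  𝟎-indicator : Ord → ℕ
  𝟎-indicator 𝟎 = 1
  𝟎-indicator (ω^ _ + _) = 0
  open TermWeight 𝟎-indicator
  open ≡-Reasoning
  fin-weight : ∀ x → fin x ≡ weight x
  fin-weight 𝟎 = refl
  fin-weight (ω^ 𝟎 + b) = cong suc (fin-weight b)
  fin-weight (ω^ (ω^ _ + _) + b) = fin-weight b

fin≤noₒ : ∀ x → fin x ≤ noₒ x
fin≤noₒ 𝟎 = z≤n
fin≤noₒ (ω^ 𝟎 + b) = s≤s (fin≤noₒ b)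
fin≤noₒ (ω^ a@(ω^ _ + _) + b) = ≤-trans (fin≤noₒ b) (m≤n+m (noₒ b) (suc (noₒ a)))

noₒ-fromℕ : ∀ k → noₒ (fromℕ k) ≡ k
noₒ-fromℕ zero = refl
noₒ-fromℕ (suc k) = cong suc (noₒ-fromℕ k)

-- Holds exactly when every exponent of x is 𝟎, i.e. when x = fromℕ (fin x).
Finite : Ord → Set
Finite x = noₒ x ≡ fin x

fromℕ-finite : ∀ k → Finite (fromℕ k)
fromℕ-finite zero = refl
fromℕ-finite (suc k) = cong suc (fromℕ-finite k)

⊕-finite : ∀ {x y} → Finite x → Finite y → Finite (x ⊕ y)
⊕-finite {x} {y} x-fin y-fin = begin
  noₒ (x ⊕ y)      ≡⟨ noₒ-⊕ x y ⟩
  noₒ x + noₒ y    ≡⟨ cong₂ _+_ x-fin y-fin ⟩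
  fin x + fin y    ≡⟨ sym (fin-⊕ x y) ⟩
  fin (x ⊕ y)      ∎
  where open ≡-Reasoning

noₒ-ωmul : ∀ a y → noₒ (ωmul a y) ≤ suc (noₒ a) * noₒ y
noₒ-ωmul a 𝟎 = z≤n
noₒ-ωmul a (ω^ c + d) = begin
  suc (noₒ (a ⊕ c) + noₒ (ωmul a d))
    ≡⟨ cong (λ z → suc (z + noₒ (ωmul a d))) (noₒ-⊕ a c) ⟩
  suc (noₒ a + noₒ c + noₒ (ωmul a d))
    ≤⟨ s≤s (+-mono-≤ (+-monoʳ-≤ (noₒ a) (m≤n*m (noₒ c) (suc (noₒ a)))) (noₒ-ωmul a d)) ⟩
  suc (noₒ a + suc (noₒ a) * noₒ c + suc (noₒ a) * noₒ d)
    ≡⟨ solve 3 (λ A C D → con 1 :+ (A :+ (con 1 :+ A) :* C :+ (con 1 :+ A) :* D)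
                         := (con 1 :+ A) :* (con 1 :+ (C :+ D))) refl (noₒ a) (noₒ c) (noₒ d) ⟩
  suc (noₒ a) * suc (noₒ c + noₒ d)
    ∎
  where open ≤-Reasoning

noₒ-⊗ : ∀ x y → noₒ (x ⊗ y) ≤ noₒ x * noₒ y
noₒ-⊗ 𝟎 y = z≤n
noₒ-⊗ (ω^ a + b) y = begin
  noₒ (ωmul a y ⊕ (b ⊗ y))           ≡⟨ noₒ-⊕ (ωmul a y) (b ⊗ y) ⟩
  noₒ (ωmul a y) + noₒ (b ⊗ y)       ≤⟨ +-mono-≤ (noₒ-ωmul a y) (noₒ-⊗ b y) ⟩
  suc (noₒ a) * noₒ y + noₒ b * noₒ y ≡⟨ sym (*-distribʳ-+ (noₒ y) (suc (noₒ a)) (noₒ b)) ⟩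
  suc (noₒ a + noₒ b) * noₒ y         ∎
  where open ≤-Reasoning

noₒ-dec1 : ∀ x → noₒ (dec1 x) ≤ noₒ x
noₒ-dec1 𝟎 = z≤n
noₒ-dec1 (ω^ 𝟎 + b) = n≤1+n _
noₒ-dec1 (ω^ (ω^ _ + _) + _) = ≤-refl

noₒ-ωquot : ∀ x → noₒ (ωquot x) ≤ noₒ x
noₒ-ωquot 𝟎 = z≤n
noₒ-ωquot (ω^ 𝟎 + b) = m≤n⇒m≤1+n (noₒ-ωquot b)
noₒ-ωquot (ω^ a@(ω^ _ + _) + b) = s≤s (+-mono-≤ (noₒ-dec1 a) (noₒ-ωquot b))

noₒ-pow2 : ∀ x → noₒ (pow2 x) ≤ suc (noₒ x) * 2 ^ noₒ x
noₒ-pow2 x = begin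
  noₒ (ωmul (ωquot x) (fromℕ (2 ^ fin x)))          ≤⟨ noₒ-ωmul (ωquot x) (fromℕ (2 ^ fin x)) ⟩
  suc (noₒ (ωquot x)) * noₒ (fromℕ (2 ^ fin x))     ≡⟨ cong (suc (noₒ (ωquot x)) *_) (noₒ-fromℕ _) ⟩
  suc (noₒ (ωquot x)) * 2 ^ fin x                    ≤⟨ *-mono-≤ (s≤s (noₒ-ωquot x)) (^-monoʳ-≤ 2 (fin≤noₒ x)) ⟩
  suc (noₒ x) * 2 ^ noₒ x                            ∎
  where open ≤-Reasoning

Monotone : (ℕ → ℕ) → Set
Monotone f = f Preserves _≤_ ⟶ _≤_

Inflationary : (ℕ → ℕ) → Set
Inflationary f = ∀ x → x ≤ f x

iter-+ : ∀ f m n x → iter f (m + n) x ≡ iter f m (iter f n x)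
iter-+ f zero n x = refl
iter-+ f (suc m) n x = cong f (iter-+ f m n x)

iter-monoʳ : ∀ {f} → Monotone f → ∀ k → Monotone (iter f k)
iter-monoʳ f-mono zero x≤y = x≤y
iter-monoʳ f-mono (suc k) x≤y = f-mono (iter-monoʳ f-mono k x≤y)

iter-inflationary : ∀ {f} → Inflationary f → ∀ k → Inflationary (iter f k)
iter-inflationary f-infl zero x = ≤-refl
iter-inflationary f-infl (suc k) x = ≤-trans (iter-inflationary f-infl k x) (f-infl _)

iter-monoˡ : ∀ {f} → Monotone f → Inflationary f → ∀ {k k′} x → k ≤ k′ → iter f k x ≤ iter f k′ x
iter-monoˡ f-mono f-infl {k′ = k′} x z≤n = iter-inflationary f-infl k′ x
iter-monoˡ f-mono f-infl x (s≤s k≤k′) = f-mono (iter-monoˡ f-mono f-infl x k≤k′)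

n<2^n : ∀ n → n < 2 ^ n
n<2^n zero = z<s
n<2^n (suc n) = +-mono-≤ (m^n>0 2 n) (≤-trans (n<2^n n) (m≤m+n (2 ^ n) 0))

mutual
  F-mono : ∀ j → Monotone (F j)
  F-mono zero = ^-monoʳ-≤ 2
  F-mono (suc j) {x} {y} x≤y =
    ≤-trans (iter-monoʳ (F-mono j) (suc x) x≤y) (iter-monoˡ (F-mono j) (F-inflationary j) y (s≤s x≤y))

  n<F : ∀ j x → x < F j x
  n<F zero x = n<2^n x
  n<F (suc j) x = <-≤-trans (n<F j x) (F-mono j (iter-inflationary (F-inflationary j) x x))

  F-inflationary : ∀ j → Inflationary (F j)
  F-inflationary j x = <⇒≤ (n<F j x)

iter-F≤F-suc : ∀ j {k} x → k ≤ suc x → iter (F j) k x ≤ F (suc j) x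
iter-F≤F-suc j x = iter-monoˡ (F-mono j) (F-inflationary j) x

iter-F-*≤iter-F-suc : ∀ j k x → iter (F j) (k * x) x ≤ iter (F (suc j)) k x
iter-F-*≤iter-F-suc j zero x = ≤-refl
iter-F-*≤iter-F-suc j (suc k) x = begin
  iter (F j) (x + k * x) x            ≡⟨ iter-+ (F j) x (k * x) x ⟩
  iter (F j) x (iter (F j) (k * x) x) ≤⟨ iter-monoʳ (F-mono j) x (iter-F-*≤iter-F-suc j k x) ⟩
  iter (F j) x y                      ≤⟨ iter-F≤F-suc j y (m≤n⇒m≤1+n x≤y) ⟩
  F (suc j) y                         ∎
  where
  open ≤-Reasoning
  y = iter (F (suc j)) k x
  x≤y : x ≤ y
  x≤y = iter-inflationary (F-inflationary (suc j)) k x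

powBound : ℕ → ℕ
powBound y = suc y * 2 ^ y * (y + y)

powBound-mono : Monotone powBound
powBound-mono x≤y = *-mono-≤ (*-mono-≤ (s≤s x≤y) (^-monoʳ-≤ 2 x≤y)) (+-mono-≤ x≤y x≤y)

powBound-inflationary : Inflationary powBound
powBound-inflationary y =
  ≤-trans (m≤m+n y y) (m≤n*m (y + y) (suc y * 2 ^ y) {{m*n≢0 (suc y) (2 ^ y) {{_}} {{m^n≢0 2 y}}}})

iter-powBound-monoˡ : ∀ {k k′} x → k ≤ k′ → iter powBound k x ≤ iter powBound k′ x
iter-powBound-monoˡ = iter-monoˡ powBound-mono powBound-inflationary

powBound≤2^2^2^2 : ∀ y → powBound y ≤ iter (F 0) 4 y
powBound≤2^2^2^2 y = begin
  suc y * 2 ^ y * (y + y)          ≤⟨ *-mono-≤ (*-monoˡ-≤ (2 ^ y) (n<2^n y)) (+-mono-≤ y≤2^y y≤2^y) ⟩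
  2 ^ y * 2 ^ y * (2 ^ y + 2 ^ y)  ≡⟨ products-of-2^y ⟩
  2 ^ (y + y + suc y)              ≤⟨ ^-monoʳ-≤ 2 exponent≤ ⟩
  2 ^ 2 ^ suc (suc y)              ≤⟨ ^-monoʳ-≤ 2 (^-monoʳ-≤ 2 (n<2^n (suc y))) ⟩
  2 ^ 2 ^ 2 ^ suc y                ≤⟨ ^-monoʳ-≤ 2 (^-monoʳ-≤ 2 (^-monoʳ-≤ 2 (n<2^n y))) ⟩
  2 ^ 2 ^ 2 ^ 2 ^ y                ∎
  where
  open ≤-Reasoning
  y≤2^y : y ≤ 2 ^ y
  y≤2^y = <⇒≤ (n<2^n y)
  products-of-2^y : 2 ^ y * 2 ^ y * (2 ^ y + 2 ^ y) ≡ 2 ^ (y + y + suc y)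
  products-of-2^y = begin-equality
    2 ^ y * 2 ^ y * (2 ^ y + 2 ^ y)  ≡⟨ cong (2 ^ y * 2 ^ y *_) (cong (2 ^ y +_) (sym (+-identityʳ (2 ^ y)))) ⟩
    2 ^ y * 2 ^ y * 2 ^ suc y        ≡⟨ cong (_* 2 ^ suc y) (sym (^-distribˡ-+-* 2 y y)) ⟩
    2 ^ (y + y) * 2 ^ suc y          ≡⟨ sym (^-distribˡ-+-* 2 (y + y) (suc y)) ⟩
    2 ^ (y + y + suc y)              ∎
  exponent≤ : y + y + suc y ≤ 2 ^ suc (suc y)
  exponent≤ = begin
    y + y + suc y                    ≤⟨ +-mono-≤ (+-mono-≤ (n≤1+n y) (n≤1+n y)) ≤-refl ⟩
    suc y + suc y + suc y            ≤⟨ +-mono-≤ (+-mono-≤ (n<2^n y) (n<2^n y)) (≤-trans (n<2^n y) (m≤m+n _ _)) ⟩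
    2 ^ y + 2 ^ y + (2 ^ y + 2 ^ y)  ≡⟨ solve 1 (λ P → P :+ P :+ (P :+ P) := con 2 :* (con 2 :* P)) refl (2 ^ y) ⟩
    2 ^ suc (suc y)                  ∎

iter-powBound≤iter-F0 : ∀ m x → iter powBound m x ≤ iter (F 0) (m * 4) x
iter-powBound≤iter-F0 zero x = ≤-refl
iter-powBound≤iter-F0 (suc m) x = begin
  powBound (iter powBound m x)                ≤⟨ powBound≤2^2^2^2 (iter powBound m x) ⟩
  iter (F 0) 4 (iter powBound m x)            ≤⟨ iter-monoʳ (F-mono 0) 4 (iter-powBound≤iter-F0 m x) ⟩
  iter (F 0) 4 (iter (F 0) (m * 4) x)         ≡⟨ sym (iter-+ (F 0) 4 (m * 4) x) ⟩
  iter (F 0) (4 + m * 4) x                    ∎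
  where open ≤-Reasoning

-- Only lower bounds by F-terms of the variable x may be used here: a closed term such as F 2 1
-- must never be unfolded, as it normalises to a numeral of astronomical size.
8≤F2 : ∀ x → 8 ≤ F 2 (suc x)
8≤F2 x = begin
  8               ≤⟨ m≤m+n 8 8 ⟩
  2 ^ 4           ≤⟨ ^-monoʳ-≤ 2 4≤F1 ⟩
  2 ^ F 1 y       ≤⟨ iter-F≤F-suc 0 {1} (F 1 y) (s≤s z≤n) ⟩
  F 1 (F 1 y)     ≤⟨ iter-F≤F-suc 1 {2} y (s≤s (s≤s z≤n)) ⟩
  F 2 y           ∎
  where
  open ≤-Reasoning
  y = suc x
  4≤F1 : 4 ≤ F 1 y
  4≤F1 = ≤-trans (^-monoʳ-≤ 2 {2} {2 ^ y} (^-monoʳ-≤ 2 {1} {y} (s≤s z≤n))) (iter-F≤F-suc 0 {2} y (s≤s (s≤s z≤n)))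

iter-F1-8<F3 : ∀ x → iter (F 1) 8 (suc x) < F 3 (suc x)
iter-F1-8<F3 x = begin-strict
  iter (F 1) 8 y                    <⟨ n<F 1 _ ⟩
  iter (F 1) 9 y                    ≤⟨ iter-monoˡ (F-mono 1) (F-inflationary 1) y (s≤s (8≤F2 x)) ⟩
  iter (F 1) (suc (F 2 y)) y        ≤⟨ iter-monoʳ (F-mono 1) (suc (F 2 y)) (F-inflationary 2 y) ⟩
  iter (F 2) 2 y                    ≤⟨ iter-F≤F-suc 2 y (s≤s (s≤s z≤n)) ⟩
  F 3 y                             ∎
  where
  open ≤-Reasoning
  y = suc x

iter-powBound<F3 : ∀ x → iter powBound (x + x) x < F 3 x
iter-powBound<F3 zero = z<s
iter-powBound<F3 x@(suc x′) = begin-strict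
  iter powBound (x + x) x       ≤⟨ iter-powBound≤iter-F0 (x + x) x ⟩
  iter (F 0) ((x + x) * 4) x    ≡⟨ cong (λ k → iter (F 0) k x) (solve 1 (λ x → (x :+ x) :* con 4 := con 8 :* x) refl x) ⟩
  iter (F 0) (8 * x) x          ≤⟨ iter-F-*≤iter-F-suc 0 8 x ⟩
  iter (F 1) 8 x                <⟨ iter-F1-8<F3 x′ ⟩
  F 3 x                         ∎
  where open ≤-Reasoning

≤ᵇ-true : ∀ {m n} → m ≤ n → (m ≤ᵇ n) ≡ true
≤ᵇ-true {m} {n} m≤n with m ≤ᵇ n | ≤⇒≤ᵇ m≤n
... | true | _ = refl

≤ᵇ-false : ∀ {m n} → n < m → (m ≤ᵇ n) ≡ false
≤ᵇ-false {m} {n} n<m with m ≤ᵇ n in eq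
... | false = refl
... | true = contradiction (≤ᵇ⇒≤ m n (subst T (sym eq) _)) (<⇒≱ n<m)

↾-comp : ∀ h {n j} → j ≤ n → comp (h ↾ n) j ≡ comp h j
↾-comp h j≤n rewrite ≤ᵇ-true j≤n = refl

□-comp-above : ∀ f g {j} → lv g ≤ j → suc j ≤ lv f → comp (f □ g) (suc j) ≡ comp f (suc j)
□-comp-above f g g≤j j<f rewrite ≤ᵇ-false (s≤s g≤j) | ≤ᵇ-true j<f = refl

□-comp-below : ∀ f g {j} → lv g < lv f → suc j ≤ lv g →
  comp (f □ g) (suc j) ≡ tpow (comp (f □ g) (suc (suc j))) (comp f (suc j) +ₜ comp g (suc j))
□-comp-below f g {j} g<f j<g rewrite ≤ᵇ-true j<g | +-∸-assoc 1 j<g with m≤n⇒m<n∨m≡n j<g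
... | inj₁ j+1<g rewrite ≤ᵇ-true j+1<g = refl
... | inj₂ j+1≡g -- g has no component j+2, so both sides fall back to comp f (j+2)
  rewrite ≤ᵇ-false (s≤s (≤-reflexive (sym j+1≡g)))
        | ≤ᵇ-true (subst (_< lv f) (sym j+1≡g) g<f)
        | m≤n⇒m∸n≡0 (≤-reflexive (sym j+1≡g)) = refl

B₀-finite : ∀ ψ {t} → B ψ 0 t → Finite (evalc ψ t)
B₀-finite ψ b1 = refl
B₀-finite ψ (b+ p q) = ⊕-finite (B₀-finite ψ p) (B₀-finite ψ q)
B₀-finite ψ (bpsi _ _ _) = fromℕ-finite _
B₀-finite ψ (b0 p) = B₀-finite ψ p

module NormBounds (ψ : Ord → ℕ) (χ : Subst ψ) where

  ‖_‖ : Tm → ℕ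
  ‖ t ‖ = noₒ (⟦_⟧ ψ t χ)

  TailNorm≤ : Vect → ℕ → Set
  TailNorm≤ h K = ∀ i → 1 ≤ i → i ≤ lv h → ‖ comp h i ‖ ≤ K

  TailNorm≤-mono : ∀ h {K K′} → TailNorm≤ h K → K ≤ K′ → TailNorm≤ h K′
  TailNorm≤-mono h h≤K K≤K′ i 1≤i i≤lv = ≤-trans (h≤K i 1≤i i≤lv) K≤K′

  ↾-TailNorm≤ : ∀ h {K n} → n ≤ lv h → TailNorm≤ h K → TailNorm≤ (h ↾ n) K
  ↾-TailNorm≤ h n≤lv h≤K i 1≤i i≤n rewrite ↾-comp h i≤n = h≤K i 1≤i (≤-trans i≤n n≤lv)

  ‖tpow-+ₜ‖≤powBound : ∀ f g h {y} → ‖ f ‖ ≤ y → ‖ g ‖ ≤ y → ‖ h ‖ ≤ y → ‖ tpow f (g +ₜ h) ‖ ≤ powBound y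
  ‖tpow-+ₜ‖≤powBound f g h {y} f≤y g≤y h≤y = begin
    noₒ (pow2 F′ ⊗ (G ⊕ H))                         ≤⟨ noₒ-⊗ (pow2 F′) (G ⊕ H) ⟩
    noₒ (pow2 F′) * noₒ (G ⊕ H)                     ≤⟨ *-mono-≤ (noₒ-pow2 F′) (≤-reflexive (noₒ-⊕ G H)) ⟩
    suc ‖ f ‖ * 2 ^ ‖ f ‖ * (‖ g ‖ + ‖ h ‖)         ≤⟨ *-mono-≤ (*-mono-≤ (s≤s f≤y) (^-monoʳ-≤ 2 f≤y)) (+-mono-≤ g≤y h≤y) ⟩
    powBound y                                      ∎
    where
    open ≤-Reasoning
    F′ G H : Ord
    F′ = ⟦_⟧ ψ f χ
    G = ⟦_⟧ ψ g χ
    H = ⟦_⟧ ψ h χ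

  □-TailNorm≤ : ∀ f g {K} → lv g < lv f → TailNorm≤ f K → TailNorm≤ g K →
    TailNorm≤ (f □ g) (iter powBound (lv g) K)
  □-TailNorm≤ f g {K} g<f f≤K g≤K (suc j) _ j<f =
    ≤-trans (bound-at (lv g ∸ j) j refl j<f) (iter-powBound-monoˡ K (m∸n≤m (lv g) j))
    where
    bound-at : ∀ t j → lv g ∸ j ≡ t → suc j ≤ lv f → ‖ comp (f □ g) (suc j) ‖ ≤ iter powBound t K
    bound-at zero j g∸j≡0 j<f rewrite □-comp-above f g (m∸n≡0⇒m≤n g∸j≡0) j<f = f≤K (suc j) (s≤s z≤n) j<f
    bound-at (suc t) j g∸j≡1+t j<f =
      ≤-trans (≤-reflexive (cong ‖_‖ (□-comp-below f g g<f j<g)))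
        (‖tpow-+ₜ‖≤powBound (comp (f □ g) (suc (suc j))) (comp f (suc j)) (comp g (suc j))
          (bound-at t (suc j) g∸1+j≡t (≤-<-trans j<g g<f))
          (≤-trans (f≤K (suc j) (s≤s z≤n) j<f) K≤iter)
          (≤-trans (g≤K (suc j) (s≤s z≤n) j<g) K≤iter))
      where
      j<g : j < lv g
      j<g = m∸n≢0⇒n<m (1+n≢0 ∘ trans (sym g∸j≡1+t))
      g∸1+j≡t : lv g ∸ suc j ≡ t
      g∸1+j≡t = trans (sym (pred[m∸n]≡m∸[1+n] (lv g) j)) (cong pred g∸j≡1+t)
      K≤iter : K ≤ iter powBound t K
      K≤iter = iter-inflationary powBound-inflationary t K

  □-□↾-TailNorm≤ : ∀ {a b c d n K} → lv a ≡ suc n → lv c ≡ suc n → lv b ≤ n → lv d ≤ n →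
    TailNorm≤ a K → TailNorm≤ b K → TailNorm≤ c K → TailNorm≤ d K →
    TailNorm≤ ((a □ b) □ ((c □ d) ↾ n)) (iter powBound (n + n) K)
  □-□↾-TailNorm≤ {a} {b} {c} {d} {n} {K} lv-a lv-c b≤n d≤n a≤K b≤K c≤K d≤K =
    subst (TailNorm≤ ((a □ b) □ ((c □ d) ↾ n))) (sym (iter-+ powBound n n K))
      (□-TailNorm≤ (a □ b) ((c □ d) ↾ n) (subst (n <_) (sym lv-a) ≤-refl)
        ab≤ (↾-TailNorm≤ (c □ d) n≤lv-c cd≤))
    where
    ab≤ : TailNorm≤ (a □ b) (iter powBound n K)
    ab≤ = TailNorm≤-mono (a □ b) (□-TailNorm≤ a b (subst (lv b <_) (sym lv-a) (s≤s b≤n)) a≤K b≤K)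
            (iter-powBound-monoˡ K b≤n)
    cd≤ : TailNorm≤ (c □ d) (iter powBound n K)
    cd≤ = TailNorm≤-mono (c □ d) (□-TailNorm≤ c d (subst (lv d <_) (sym lv-c) (s≤s d≤n)) c≤K d≤K)
            (iter-powBound-monoˡ K d≤n)
    n≤lv-c : n ≤ lv c
    n≤lv-c = subst (n ≤_) (sym lv-c) (n≤1+n n)

  fin-+ₜˡ : ∀ s t → fin (⟦_⟧ ψ s χ) ≤ fin (⟦_⟧ ψ (s +ₜ t) χ)
  fin-+ₜˡ s t = ≤-trans (m≤m+n _ _) (≤-reflexive (sym (fin-⊕ (⟦_⟧ ψ s χ) (⟦_⟧ ψ t χ))))

  fin-+ₜʳ : ∀ s t → fin (⟦_⟧ ψ t χ) ≤ fin (⟦_⟧ ψ (s +ₜ t) χ)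
  fin-+ₜʳ s t = ≤-trans (m≤n+m _ _) (≤-reflexive (sym (fin-⊕ (⟦_⟧ ψ s χ) (⟦_⟧ ψ t χ))))

  fin-num : ∀ n → fin (⟦_⟧ ψ (num n) χ) ≡ n
  fin-num zero = refl
  fin-num (suc n) = trans (fin-⊕ oneₒ (⟦_⟧ ψ (num n) χ)) (cong suc (fin-num n))

  module _ {lvV : ℕ → ℕ} (adm : Admissible ψ lvV χ) where

    C₀-finite : ∀ {t} → C ψ lvV 0 t → Finite (⟦_⟧ ψ t χ)
    C₀-finite c1 = refl
    C₀-finite (cvar {v} i≤lv) = B₀-finite ψ (proj₁ (proj₁ (adm v 0) i≤lv))
    C₀-finite (c+ p q) = ⊕-finite (C₀-finite p) (C₀-finite q)
    C₀-finite (cpsi _ _ _) = fromℕ-finite _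
    C₀-finite (c0 p) = C₀-finite p

    TailNorm≤-fin₀ : ∀ h {K} → InC ψ lvV h → BoundedNorm ψ lvV h → fin (⟦_⟧ ψ (comp h 0) χ) ≤ K →
      TailNorm≤ h K
    TailNorm≤-fin₀ h {K} h∈C h-bounded h₀≤K i _ i≤lv = begin
      ‖ comp h i ‖              ≤⟨ h-bounded i i≤lv χ adm ⟩
      ‖ comp h 0 ‖              ≡⟨ C₀-finite (h∈C 0 z≤n) ⟩
      fin (⟦_⟧ ψ (comp h 0) χ)  ≤⟨ h₀≤K ⟩
      K                         ∎
      where open ≤-Reasoning

lemma2p17 : (ψ : Ord → ℕ) → IsPsi ψ → (lvV : ℕ → ℕ) → (n : ℕ) → (a b c d : Vect) →
    InC ψ lvV a → InC ψ lvV b → InC ψ lvV c → InC ψ lvV d →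
    BoundedNorm ψ lvV a → BoundedNorm ψ lvV b → BoundedNorm ψ lvV c → BoundedNorm ψ lvV d →
    lv a ≡ suc n → lv c ≡ suc n → lv b < suc n → lv d < suc n →
    ∀ i → 1 ≤ i → i ≤ suc n → ∀ χ → Admissible ψ lvV χ →
      noₒ (⟦_⟧ ψ (comp ((a □ b) □ ((c □ d) ↾ n)) i) χ)
        < F 3 (fin (⟦_⟧ ψ ((((comp a 0 +ₜ comp b 0) +ₜ comp c 0) +ₜ comp d 0) +ₜ num n) χ))
lemma2p17 ψ _ lvV n a b c d a∈C b∈C c∈C d∈C a-bn b-bn c-bn d-bn lv-a lv-c b<n+1 d<n+1 i 1≤i i≤n+1 χ adm =
  begin-strict
    ‖ comp ((a □ b) □ ((c □ d) ↾ n)) i ‖  ≤⟨ e≤ i 1≤i (subst (i ≤_) (sym lv-a) i≤n+1) ⟩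
    iter powBound (n + n) A              ≤⟨ iter-powBound-monoˡ A (+-mono-≤ n≤A n≤A) ⟩
    iter powBound (A + A) A              <⟨ iter-powBound<F3 A ⟩
    F 3 A                                ∎
  where
  open ≤-Reasoning
  open NormBounds ψ χ
  sum₂ sum₃ sum₄ : Tm
  sum₂ = comp a 0 +ₜ comp b 0
  sum₃ = sum₂ +ₜ comp c 0
  sum₄ = sum₃ +ₜ comp d 0
  A : ℕ
  A = fin (⟦_⟧ ψ (sum₄ +ₜ num n) χ)
  sum₄≤A : fin (⟦_⟧ ψ sum₄ χ) ≤ A
  sum₄≤A = fin-+ₜˡ sum₄ (num n)
  sum₃≤A : fin (⟦_⟧ ψ sum₃ χ) ≤ A
  sum₃≤A = ≤-trans (fin-+ₜˡ sum₃ (comp d 0)) sum₄≤A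
  sum₂≤A : fin (⟦_⟧ ψ sum₂ χ) ≤ A
  sum₂≤A = ≤-trans (fin-+ₜˡ sum₂ (comp c 0)) sum₃≤A
  n≤A : n ≤ A
  n≤A = subst (_≤ A) (fin-num n) (fin-+ₜʳ sum₄ (num n))
  e≤ : TailNorm≤ ((a □ b) □ ((c □ d) ↾ n)) (iter powBound (n + n) A)
  e≤ = □-□↾-TailNorm≤ lv-a lv-c (≤-pred b<n+1) (≤-pred d<n+1)
    (TailNorm≤-fin₀ adm a a∈C a-bn (≤-trans (fin-+ₜˡ (comp a 0) (comp b 0)) sum₂≤A))
    (TailNorm≤-fin₀ adm b b∈C b-bn (≤-trans (fin-+ₜʳ (comp a 0) (comp b 0)) sum₂≤A))
    (TailNorm≤-fin₀ adm c c∈C c-bn (≤-trans (fin-+ₜʳ sum₂ (comp c 0)) sum₃≤A))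
    (TailNorm≤-fin₀ adm d d∈C d-bn (≤-trans (fin-+ₜʳ sum₃ (comp d 0)) sum₄≤A))
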